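{- For every integer $n \ge 2$ there exists a Sarvate--Beam cube of order $n$; that is, there exists a function $C:[n]^3 \to \mathbb{Z}_{\ge 0}$ whose $3n^2$ line sums (in the directions of the three coordinate axes) are, as a multiset, exactly the integers $0,1,2,\dots,3n^2-1$.
   Context: Here $[n]=\{1,\dots,n\}$. For $C:[n]^3\to\mathbb{Z}_{\ge 0}$, the line sums are the $3n^2$ numbers $\sum_{k} C(i,j,k)$ for $(i,j)\in[n]^2$, $\sum_{j} C(i,j,k)$ for $(i,k)\in[n]^2$, and $\sum_{i} C(i,j,k)$ for $(j,k)\in[n]^2$. A Sarvate--Beam cube of order $n$, SBC$(n)$, is such a $C$ whose $3n^2$ line sums are $0,1,\dots,3n^2-1$, each occurring exactly once. -}

module Defs where

open import Data.Nat using (ℕ; zero; suc; _+_; _*_)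
open import Data.Fin using (Fin; zero; suc)
open import Data.List using (List; []; _∷_; _++_; map; concatMap; allFin; upTo)
open import Data.List.Relation.Binary.Permutation.Propositional using (_↭_)

∑ : {n : ℕ} → (Fin n → ℕ) → ℕ
∑ {zero}  f = 0
∑ {suc n} f = f zero + ∑ (λ i → f (suc i))

Cube : ℕ → Set
Cube n = Fin n → Fin n → Fin n → ℕ

pairsMap : {n : ℕ} → (Fin n → Fin n → ℕ) → List ℕ
pairsMap {n} g = concatMap (λ a → map (λ b → g a b) (allFin n)) (allFin n)

lineSums : {n : ℕ} → Cube n → List ℕ
lineSums C =
     pairsMap (λ i j → ∑ (λ k → C i j k))
  ++ pairsMap (λ i k → ∑ (λ j → C i j k))
  ++ pairsMap (λ j k → ∑ (λ i → C i j k))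

IsSBC : (n : ℕ) → Cube n → Set
IsSBC n C = lineSums C ↭ upTo (3 * (n * n))

-- Line sums are arranged to be 3(nx + y) + r with r ∈ {0, 1, 2}. The cube carries 3(nx + y) at
-- (x, y, x + y mod n); every line meets exactly one such base cell, and the three lines through the
-- base cell (x, y) all start from 3(nx + y). Small weights are put on the diagonals z = x + y + c for
-- c = 1, −1, 2, with values depending only on x − y mod n through a cyclic word of triples: the three
-- lines through (x, y) then pick up excesses determined by the five letters around position x − y,
-- and the word is chosen so that these are 0, 1, 2 in some order. Such words of every length n ≥ 4
-- are a fixed block of length 4 repeated, followed by one of four tails. As there are exactly 3n² line
-- sums, it then suffices that each of 0, …, 3n² − 1 occurs. Orders 2 and 3 are checked by evaluation.

module Submission where

open import Defs
open import Data.Bool using (if_then_else_)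
open import Data.Fin using (Fin; zero; suc; toℕ; fromℕ<; combine; remQuot)
open import Data.Fin.Properties using (toℕ-injective; toℕ-fromℕ<; toℕ<n; toℕ-combine; combine-remQuot)
import Data.Fin.Properties as Fin
open import Data.List using (List; []; _∷_; _++_; map; concatMap; allFin; upTo; length)
open import Data.List.Membership.Propositional using (_∈_; lose)
open import Data.List.Membership.Propositional.Properties
  using (∈-∃++; ∈-++⁻; ∈-++⁺ˡ; ∈-++⁺ʳ; ∈-map⁺; ∈-allFin; ∈-concatMap⁺; ∈-upTo⁺; ∈-upTo⁻)
open import Data.List.Properties using (length-++; length-map; length-tabulate; length-upTo; length-++-sucʳ)
open import Data.List.Relation.Binary.Permutation.Propositional using (_↭_; ↭-refl; ↭-trans; ↭-prep)
open import Data.List.Relation.Binary.Permutation.Propositional.Properties using (shift)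
open import Data.List.Relation.Unary.All using (All; []; _∷_; all?)
import Data.List.Relation.Unary.All as All
open import Data.List.Relation.Unary.AllPairs using (_∷_)
open import Data.List.Relation.Unary.Any using (here; there)
open import Data.List.Relation.Unary.Unique.Propositional using (Unique)
open import Data.List.Relation.Unary.Unique.Propositional.Properties using (upTo⁺)
open import Data.Nat using (ℕ; zero; suc; _+_; _*_; _<_; _≤_; s≤s; z≤n; _≟_; _<?_; _%_; _/_)
open import Data.Nat.DivMod
  using (_mod_; m%n%n≡m%n; %-distribˡ-+; %-distribˡ-*; n%n≡0; [m+n]%n≡m%n; [m+kn]%n≡m%n; m<n⇒m%n≡m; m%n<n;
         m≡m%n+[m/n]*n)
open import Data.Nat.Properties
  using (suc-injective; +-comm; *-comm; +-identityʳ; +-commutativeSemigroup; ≮⇒≥; m≤n⇒∃[o]m+o≡n; +-cancelˡ-<;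
         ≤-trans; ≤-refl; m≤m+n; +-mono-<-≤; ≤-pred)
open import Data.Nat.Tactic.RingSolver using (solve-∀)
open import Data.List.Membership.DecPropositional _≟_ using (_∈?_)
open import Algebra.Properties.CommutativeSemigroup +-commutativeSemigroup using (interchange; xy∙z≈xz∙y)
open import Data.Product using (Σ; ∃; ∃₂; _×_; _,_; proj₁; proj₂)
open import Data.Sum using (inj₁; inj₂)
open import Function using (_∘_)
open import Level using (0ℓ)
open import Relation.Binary.Bundles using (Setoid)
open import Relation.Binary.PropositionalEquality
import Relation.Binary.Reasoning.Setoid as ≈-Reasoning
open import Relation.Nullary using (Dec; yes; no; does; contradiction)
open import Relation.Nullary.Decidable using (True; toWitness; dec-true; dec-false)

-- Counting line sums

∈-++-drop-mid : ∀ {v z : ℕ} xs ys → z ∈ xs ++ v ∷ ys → z ≢ v → z ∈ xs ++ ys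
∈-++-drop-mid xs ys z∈ z≢v with ∈-++⁻ xs z∈
... | inj₁ z∈xs         = ∈-++⁺ˡ z∈xs
... | inj₂ (here z≡v)   = contradiction z≡v z≢v
... | inj₂ (there z∈ys) = ∈-++⁺ʳ xs z∈ys

⊆∧length⇒↭ : ∀ xs ys → Unique ys → (∀ {v} → v ∈ ys → v ∈ xs) → length xs ≡ length ys → xs ↭ ys
⊆∧length⇒↭ []       []       _             _    _   = ↭-refl
⊆∧length⇒↭ (_ ∷ _)  []       _             _    ()
⊆∧length⇒↭ xs       (y ∷ ys) (y∉ys ∷ !ys)  ys⊆xs |xs|≡ with ∈-∃++ (ys⊆xs (here refl))
... | as , bs , refl = ↭-trans (shift y as bs) (↭-prep y (⊆∧length⇒↭ (as ++ bs) ys !ys ys⊆as++bs |as++bs|≡))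
  where
  ys⊆as++bs : ∀ {v} → v ∈ ys → v ∈ as ++ bs
  ys⊆as++bs v∈ys = ∈-++-drop-mid as bs (ys⊆xs (there v∈ys)) (λ v≡y → All.lookup y∉ys v∈ys (sym v≡y))
  |as++bs|≡ : length (as ++ bs) ≡ length ys
  |as++bs|≡ = suc-injective (trans (sym (length-++-sucʳ as y bs)) |xs|≡)

length-concatMap-const : ∀ {A B : Set} (f : A → List B) {k} → (∀ a → length (f a) ≡ k) →
                         ∀ xs → length (concatMap f xs) ≡ length xs * k
length-concatMap-const f |f|≡k []       = refl
length-concatMap-const f |f|≡k (x ∷ xs) =
  trans (length-++ (f x)) (cong₂ _+_ (|f|≡k x) (length-concatMap-const f |f|≡k xs))

length-pairsMap : ∀ {n} (g : Fin n → Fin n → ℕ) → length (pairsMap g) ≡ n * n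
length-pairsMap {n} g =
  trans (length-concatMap-const _ |row|≡n (allFin n)) (cong (_* n) (length-tabulate {n = n} (λ i → i)))
  where
  |row|≡n : ∀ a → length (map (g a) (allFin n)) ≡ n
  |row|≡n a = trans (length-map (g a) (allFin n)) (length-tabulate {n = n} (λ i → i))

length-lineSums : ∀ {n} (C : Cube n) → length (lineSums C) ≡ 3 * (n * n)
length-lineSums {n} C = begin
  length (pairsMap lineK ++ pairsMap lineJ ++ pairsMap lineI)
    ≡⟨ length-++ (pairsMap lineK) ⟩
  length (pairsMap lineK) + length (pairsMap lineJ ++ pairsMap lineI)
    ≡⟨ cong (length (pairsMap lineK) +_) (length-++ (pairsMap lineJ)) ⟩
  length (pairsMap lineK) + (length (pairsMap lineJ) + length (pairsMap lineI))
    ≡⟨ cong₂ _+_ (length-pairsMap lineK) (cong₂ _+_ (length-pairsMap lineJ) (length-pairsMap lineI)) ⟩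
  n * n + (n * n + n * n)
    ≡⟨ cong (λ t → n * n + (n * n + t)) (sym (+-identityʳ (n * n))) ⟩
  3 * (n * n) ∎
  where
  open ≡-Reasoning
  lineK lineJ lineI : Fin n → Fin n → ℕ
  lineK i j = ∑ (λ k → C i j k)
  lineJ i k = ∑ (λ j → C i j k)
  lineI j k = ∑ (λ i → C i j k)

∈-pairsMap : ∀ {n} (g : Fin n → Fin n → ℕ) a b → g a b ∈ pairsMap g
∈-pairsMap {n} g a b = ∈-concatMap⁺ _ (lose (∈-allFin a) (∈-map⁺ (g a) (∈-allFin b)))

∑ₖ∈lineSums : ∀ {n} (C : Cube n) i j → ∑ (λ k → C i j k) ∈ lineSums C
∑ₖ∈lineSums C i j = ∈-++⁺ˡ (∈-pairsMap _ i j)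

∑ⱼ∈lineSums : ∀ {n} (C : Cube n) i k → ∑ (λ j → C i j k) ∈ lineSums C
∑ⱼ∈lineSums C i k = ∈-++⁺ʳ (pairsMap (λ i j → ∑ (C i j))) (∈-++⁺ˡ (∈-pairsMap _ i k))

∑ᵢ∈lineSums : ∀ {n} (C : Cube n) j k → ∑ (λ i → C i j k) ∈ lineSums C
∑ᵢ∈lineSums C j k = ∈-++⁺ʳ (pairsMap (λ i j → ∑ (C i j)))
  (∈-++⁺ʳ (pairsMap (λ i k → ∑ (λ j → C i j k))) (∈-pairsMap (λ j k → ∑ (λ i → C i j k)) j k))

isSBC-if-all-occur : ∀ {n} (C : Cube n) → (∀ v → v < 3 * (n * n) → v ∈ lineSums C) → IsSBC n C
isSBC-if-all-occur C occurs =
  ⊆∧length⇒↭ (lineSums C) (upTo _) (upTo⁺ _) (λ v∈ → occurs _ (∈-upTo⁻ v∈))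
    (trans (length-lineSums C) (sym (length-upTo _)))

digits : ∀ n v → v < 3 * (n * n) →
         ∃₂ λ (i j : Fin n) → ∃ λ (r : Fin 3) → v ≡ 3 * (n * toℕ i + toℕ j) + toℕ r
digits n v v<3n² = i , j , r , (begin
  v                                 ≡⟨ toℕ-fromℕ< v<n²3 ⟨
  toℕ v′                            ≡⟨ cong toℕ (combine-remQuot {n * n} 3 v′) ⟨
  toℕ (combine ij r)                ≡⟨ toℕ-combine ij r ⟩
  3 * toℕ ij + toℕ r                ≡⟨ cong (λ t → 3 * t + toℕ r) (cong toℕ (combine-remQuot {n} n ij)) ⟨
  3 * toℕ (combine i j) + toℕ r     ≡⟨ cong (λ t → 3 * t + toℕ r) (toℕ-combine i j) ⟩
  3 * (n * toℕ i + toℕ j) + toℕ r   ∎)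
  where
  open ≡-Reasoning
  v<n²3 : v < n * n * 3
  v<n²3 = subst (v <_) (*-comm 3 (n * n)) v<3n²
  v′ : Fin (n * n * 3)
  v′ = fromℕ< v<n²3
  ij : Fin (n * n)
  ij = proj₁ (remQuot {n * n} 3 v′)
  r : Fin 3
  r = proj₂ (remQuot {n * n} 3 v′)
  i j : Fin n
  i = proj₁ (remQuot {n} n ij)
  j = proj₂ (remQuot {n} n ij)

∑-distrib-+ : ∀ {n} (f g : Fin n → ℕ) → ∑ (λ i → f i + g i) ≡ ∑ f + ∑ g
∑-distrib-+ {zero}  f g = refl
∑-distrib-+ {suc n} f g = trans (cong (f zero + g zero +_) (∑-distrib-+ (λ i → f (suc i)) (λ i → g (suc i))))
                        (interchange (f zero) (g zero) _ _)

∑-cong : ∀ {n} {f g : Fin n → ℕ} → (∀ i → f i ≡ g i) → ∑ f ≡ ∑ g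
∑-cong {zero}  f≗g = refl
∑-cong {suc n} f≗g = cong₂ _+_ (f≗g zero) (∑-cong (λ i → f≗g (suc i)))

∑-zero : ∀ {n} (f : Fin n → ℕ) → (∀ i → f i ≡ 0) → ∑ f ≡ 0
∑-zero {zero}  f f≗0 = refl
∑-zero {suc n} f f≗0 = cong₂ _+_ (f≗0 zero) (∑-zero (λ i → f (suc i)) (λ i → f≗0 (suc i)))

∑-single : ∀ {n} (f : Fin n → ℕ) i → (∀ j → j ≢ i → f j ≡ 0) → ∑ f ≡ f i
∑-single f zero    f≗0 = trans (cong (f zero +_) (∑-zero _ (λ j → f≗0 (suc j) λ ()))) (+-identityʳ (f zero))
∑-single f (suc i) f≗0 =
  cong₂ _+_ (f≗0 zero λ ()) (∑-single (λ j → f (suc j)) i (λ j j≢i → f≗0 (suc j) (j≢i ∘ Fin.suc-injective)))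

point : ℕ → ℕ → ℕ → ℕ
point s v z = if does (z ≟ s) then v else 0

point-≡ : ∀ {s v z} → z ≡ s → point s v z ≡ v
point-≡ {s} {v} {z} z≡s = cong (λ b → if b then v else 0) (dec-true (z ≟ s) z≡s)

point-≢ : ∀ {s v z} → z ≢ s → point s v z ≡ 0
point-≢ {s} {v} {z} z≢s = cong (λ b → if b then v else 0) (dec-false (z ≟ s) z≢s)

∑-point : ∀ {n s} v → s < n → ∑ {n} (λ t → point s v (toℕ t)) ≡ v
∑-point {n} {s} v s<n =
  trans (∑-single {n} (λ t → point s v (toℕ t)) (fromℕ< s<n) vanishes) (point-≡ (toℕ-fromℕ< s<n))
  where
  vanishes : ∀ t → t ≢ fromℕ< s<n → point s v (toℕ t) ≡ 0
  vanishes t t≢s = point-≢ (λ t≡s → t≢s (toℕ-injective (trans t≡s (sym (toℕ-fromℕ< s<n)))))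

∑-distrib-+₄ : ∀ {n} (f₀ f₁ f₂ f₃ : Fin n → ℕ) →
       ∑ (λ t → f₀ t + (f₁ t + f₂ t + f₃ t)) ≡ ∑ f₀ + (∑ f₁ + ∑ f₂ + ∑ f₃)
∑-distrib-+₄ f₀ f₁ f₂ f₃ =
  trans (∑-distrib-+ f₀ _) (cong (∑ f₀ +_) (trans (∑-distrib-+ _ f₃) (cong (_+ ∑ f₃) (∑-distrib-+ f₁ f₂))))

-- Cyclic words and their windows

V : Set
V = ℕ × ℕ × ℕ

Window : Set → Set
Window A = A × A × A × A × A

window : ∀ {A : Set} → (ℕ → A) → ℕ → Window A
window g s = g (s + 0) , g (s + 1) , g (s + 2) , g (s + 3) , g (s + 4)

Covers : ℕ → ℕ → ℕ → Set
Covers a b c = All (_∈ a ∷ b ∷ c ∷ []) (upTo 3)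

h₁ h₂ h₃ : V → ℕ
h₁ = proj₁
h₂ = proj₁ ∘ proj₂
h₃ = proj₂ ∘ proj₂

-- A window holds the letters at positions ε − 2, …, ε + 2 of a word; the three sums are the excesses
-- of the three lines through a base cell (x, y) with x − y ≡ ε (Construction.excessₖ, excessⱼ, excessᵢ).
Balanced : Window V → Set
Balanced ((_ , _ , c₀) , (a₁ , b₁ , _) , (a₂ , b₂ , c₂) , (a₃ , b₃ , _) , (_ , _ , c₄)) =
  Covers (a₂ + b₂ + c₂) (a₃ + b₁ + c₄) (a₁ + b₃ + c₀)

State : Set → Set
State A = A × A × A × A

module _ {A : Set} where

  toList₄ : State A → List A
  toList₄ (a , b , c , d) = a ∷ b ∷ c ∷ d ∷ []

  windowsFrom : State A → List A → List (Window A)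
  windowsFrom _               []       = []
  windowsFrom (a , b , c , d) (e ∷ es) = (a , b , c , d , e) ∷ windowsFrom (b , c , d , e) es

  blocks : ℕ → State A → List A
  blocks zero    a = []
  blocks (suc k) a = toList₄ a ++ blocks k a

  length-blocks : ∀ k a → length (blocks k a) ≡ k * 4
  length-blocks zero    a = refl
  length-blocks (suc k) a = cong (4 +_) (length-blocks k a)

  module _ {P : Window A → Set} where

    All-windowsFrom-blocks : ∀ {a xs ys} → All P (windowsFrom a (toList₄ a)) → All P (windowsFrom a (xs ++ ys)) →
                             ∀ k → All P (windowsFrom a ((blocks k a ++ xs) ++ ys))
    All-windowsFrom-blocks aa ays zero = ays
    All-windowsFrom-blocks aa@(p₁ ∷ p₂ ∷ p₃ ∷ p₄ ∷ []) ays (suc k) =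
      p₁ ∷ p₂ ∷ p₃ ∷ p₄ ∷ All-windowsFrom-blocks aa ays k

    All-windowsFrom-cyclic : ∀ {f a body} →
      All P (windowsFrom f (body ++ toList₄ f)) → All P (windowsFrom f (toList₄ a)) →
      All P (windowsFrom a (toList₄ a)) → All P (windowsFrom a (body ++ toList₄ f)) →
      ∀ k → All P (windowsFrom f ((blocks k a ++ body) ++ toList₄ f))
    All-windowsFrom-cyclic f-body _ _ _ zero = f-body
    All-windowsFrom-cyclic _ (q₁ ∷ q₂ ∷ q₃ ∷ q₄ ∷ []) aa a-body (suc k) =
      q₁ ∷ q₂ ∷ q₃ ∷ q₄ ∷ All-windowsFrom-blocks aa a-body k

  module _ (blank : A) where

    at : List A → ℕ → A
    at []       _       = blank
    at (x ∷ xs) zero    = x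
    at (x ∷ xs) (suc i) = at xs i

    at-++ˡ : ∀ xs {ys i} → i < length xs → at (xs ++ ys) i ≡ at xs i
    at-++ˡ (x ∷ xs) {i = zero}  _         = refl
    at-++ˡ (x ∷ xs) {i = suc i} (s≤s i<n) = at-++ˡ xs i<n

    at-++ʳ : ∀ xs {ys} i → at (xs ++ ys) (length xs + i) ≡ at ys i
    at-++ʳ []       i = refl
    at-++ʳ (x ∷ xs) i = at-++ʳ xs i

    window-∈-windowsFrom : ∀ s xs {j} → j < length xs → window (at (toList₄ s ++ xs)) j ∈ windowsFrom s xs
    window-∈-windowsFrom s (e ∷ es) {zero}  _         = here refl
    window-∈-windowsFrom (a , b , c , d) (e ∷ es) {suc j} (s≤s j<n) = there (window-∈-windowsFrom (b , c , d , e) es j<n)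

    windows-of-cycle : ∀ {P : Window A → Set} f u → All P (windowsFrom f (u ++ toList₄ f)) →
                       ∀ s → P (window (λ a → at (toList₄ f ++ u) (a % (4 + length u))) s)
    windows-of-cycle {P} f u all-P s =
      subst P (cong₂ _,_ (letter 0 (s≤s z≤n)) (cong₂ _,_ (letter 1 (s≤s (s≤s z≤n)))
                (cong₂ _,_ (letter 2 (s≤s (s≤s (s≤s z≤n))))
                (cong₂ _,_ (letter 3 (s≤s (s≤s (s≤s (s≤s z≤n))))) (letter 4 ≤-refl)))))
              (All.lookup all-P (window-∈-windowsFrom f (u ++ F) j<|u++F|))
      where
      N : ℕ
      N = 4 + length u
      w F : List A
      w = toList₄ f ++ u
      F = toList₄ f
      j : ℕ
      j = s % N
      j<|u++F| : j < length (u ++ F)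
      j<|u++F| = subst (j <_) (trans (+-comm 4 (length u)) (sym (length-++ u))) (m%n<n s N)
      at-cyclic : ∀ {i} → i < N + 4 → at (w ++ F) i ≡ at w (i % N)
      at-cyclic {i} i<N+4 with i <? N
      ... | yes i<N = trans (at-++ˡ w i<N) (cong (at w) (sym (m<n⇒m%n≡m i<N)))
      ... | no i≮N with m≤n⇒∃[o]m+o≡n (≮⇒≥ i≮N)
      ...   | i′ , refl = begin
        at (w ++ F) (N + i′)   ≡⟨ at-++ʳ w i′ ⟩
        at F i′                ≡⟨ at-++ˡ F i′<4 ⟨
        at w i′                ≡⟨ cong (at w) (m<n⇒m%n≡m (≤-trans i′<4 (m≤m+n 4 (length u)))) ⟨
        at w (i′ % N)          ≡⟨ cong (at w) ([m+n]%n≡m%n i′ N) ⟨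
        at w ((i′ + N) % N)    ≡⟨ cong (λ t → at w (t % N)) (+-comm i′ N) ⟩
        at w ((N + i′) % N)    ∎
        where
        open ≡-Reasoning
        i′<4 : i′ < 4
        i′<4 = +-cancelˡ-< N i′ 4 i<N+4
      letter : ∀ i → i < 5 → at (w ++ F) (j + i) ≡ at w ((s + i) % N)
      letter i i<5 = trans (at-cyclic (+-mono-<-≤ (m%n<n s N) (≤-pred i<5))) (cong (at w) (begin
        (s % N + i) % N             ≡⟨ %-distribˡ-+ (s % N) i N ⟩
        (s % N % N + i % N) % N     ≡⟨ cong (λ t → (t + i % N) % N) (m%n%n≡m%n s N) ⟩
        (s % N + i % N) % N         ≡⟨ %-distribˡ-+ s i N ⟨
        (s + i) % N                 ∎))
        where open ≡-Reasoning

-- The cube of a cyclic word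

module Construction (m : ℕ) (word : ℕ → V) where

  n : ℕ
  n = suc m

  infix 4 _≋_
  record _≋_ (a b : ℕ) : Set where
    constructor mod≡
    field %≡ : a % n ≡ b % n
  open _≋_

  ≋-setoid : Setoid 0ℓ 0ℓ
  ≋-setoid = record
    { Carrier = ℕ
    ; _≈_ = _≋_
    ; isEquivalence = record
      { refl = mod≡ refl
      ; sym = λ a≋b → mod≡ (sym (%≡ a≋b))
      ; trans = λ a≋b b≋c → mod≡ (trans (%≡ a≋b) (%≡ b≋c))
      }
    }
  open Setoid ≋-setoid using () renaming (refl to ≋-refl; sym to ≋-sym; trans to ≋-trans; reflexive to ≋-reflexive)

  %-≋ : ∀ a → a % n ≋ a
  %-≋ a = mod≡ (m%n%n≡m%n a n)

  ≋-+ : ∀ {a b c d} → a ≋ b → c ≋ d → a + c ≋ b + d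
  ≋-+ {a} {b} {c} {d} (mod≡ a≋b) (mod≡ c≋d) = mod≡ (begin
    (a + c) % n           ≡⟨ %-distribˡ-+ a c n ⟩
    (a % n + c % n) % n   ≡⟨ cong₂ (λ u v → (u + v) % n) a≋b c≋d ⟩
    (b % n + d % n) % n   ≡⟨ %-distribˡ-+ b d n ⟨
    (b + d) % n           ∎)
    where open ≡-Reasoning

  ≋-*ˡ : ∀ c {a b} → a ≋ b → c * a ≋ c * b
  ≋-*ˡ c {a} {b} (mod≡ a≋b) = mod≡ (begin
    (c * a) % n           ≡⟨ %-distribˡ-* c a n ⟩
    (c % n * (a % n)) % n ≡⟨ cong (λ u → (c % n * u) % n) a≋b ⟩
    (c % n * (b % n)) % n ≡⟨ %-distribˡ-* c b n ⟨
    (c * b) % n           ∎)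
    where open ≡-Reasoning

  ≋-by : ∀ {a b} j k → a + j * n ≡ b + k * n → a ≋ b
  ≋-by {a} {b} j k eq = mod≡ (trans (sym ([m+kn]%n≡m%n a j n)) (trans (cong (_% n) eq) ([m+kn]%n≡m%n b k n)))

  ≋⇒≡ : ∀ {a b} → a < n → b < n → a ≋ b → a ≡ b
  ≋⇒≡ a<n b<n (mod≡ a≋b) = trans (sym (m<n⇒m%n≡m a<n)) (trans a≋b (m<n⇒m%n≡m b<n))

  -- z − a modulo n, as m ≡ −1
  infixl 6 _⊖_
  _⊖_ : ℕ → ℕ → ℕ
  z ⊖ a = (z + m * a) % n

  +⊖ : ∀ a z → a + (z ⊖ a) ≋ z
  +⊖ a z = begin
    a + (z ⊖ a)         ≈⟨ ≋-+ ≋-refl (%-≋ (z + m * a)) ⟩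
    a + (z + m * a)     ≈⟨ ≋-by 0 a (identity m a z) ⟩
    z                   ∎
    where
    open ≈-Reasoning ≋-setoid
    identity : ∀ m a z → a + (z + m * a) + 0 * suc m ≡ z + a * suc m
    identity = solve-∀

  ⊖-unique : ∀ a z {t} → t < n → a + t ≋ z → t ≡ z ⊖ a
  ⊖-unique a z {t} t<n a+t≋z = ≋⇒≡ t<n (m%n<n (z + m * a) n) (begin
    t                   ≈⟨ ≋-by a 0 (identity m a t) ⟩
    a + t + m * a       ≈⟨ ≋-+ a+t≋z ≋-refl ⟩
    z + m * a           ≈⟨ %-≋ (z + m * a) ⟨
    z ⊖ a               ∎)
    where
    open ≈-Reasoning ≋-setoid
    identity : ∀ m a t → t + a * suc m ≡ a + t + m * a + 0 * suc m
    identity = solve-∀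

  ∑-point-shifted : ∀ a (g : ℕ → ℕ) {z} → z < n →
                    ∑ {n} (λ t → point ((a + toℕ t) % n) (g (toℕ t)) z) ≡ g (z ⊖ a)
  ∑-point-shifted a g {z} z<n =
    trans (∑-single {n} (λ t → point ((a + toℕ t) % n) (g (toℕ t)) z) t₀ vanishes) at-t₀
    where
    t₀ : Fin n
    t₀ = fromℕ< (m%n<n (z + m * a) n)
    toℕ-t₀ : toℕ t₀ ≡ z ⊖ a
    toℕ-t₀ = toℕ-fromℕ< (m%n<n (z + m * a) n)
    hits : ∀ {t} → t < n → z ≡ (a + t) % n → t ≡ z ⊖ a
    hits t<n z≡ = ⊖-unique a z t<n (mod≡ (trans (sym z≡) (sym (m<n⇒m%n≡m z<n))))
    vanishes : ∀ t → t ≢ t₀ → point ((a + toℕ t) % n) (g (toℕ t)) z ≡ 0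
    vanishes t t≢t₀ = point-≢ (λ z≡ → t≢t₀ (toℕ-injective (trans (hits (toℕ<n t) z≡) (sym toℕ-t₀))))
    at-t₀ : point ((a + toℕ t₀) % n) (g (toℕ t₀)) z ≡ g (z ⊖ a)
    at-t₀ rewrite toℕ-t₀ = point-≡ (trans (sym (m<n⇒m%n≡m z<n)) (sym (%≡ (+⊖ a z))))

  layer : ℕ → (ℕ → ℕ → ℕ) → ℕ → ℕ → ℕ → ℕ
  layer c f x y = point ((c + x + y) % n) (f x y)

  ∑ₖ-layer : ∀ c f x y → ∑ {n} (λ k → layer c f x y (toℕ k)) ≡ f x y
  ∑ₖ-layer c f x y = ∑-point (f x y) (m%n<n (c + x + y) n)

  ∑ⱼ-layer : ∀ c f x {z} → z < n → ∑ {n} (λ j → layer c f x (toℕ j) z) ≡ f x (z ⊖ (c + x))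
  ∑ⱼ-layer c f x = ∑-point-shifted (c + x) (f x)

  ∑ᵢ-layer : ∀ c f y {z} → z < n → ∑ {n} (λ i → layer c f (toℕ i) y z) ≡ f (z ⊖ (c + y)) y
  ∑ᵢ-layer c f y {z} z<n =
    trans (∑-cong {n} (λ i → cong (λ s → point (s % n) (f (toℕ i) y) z) (xy∙z≈xz∙y c (toℕ i) y)))
          (∑-point-shifted (c + y) (λ x → f x y) z<n)

  G : ℕ → V
  G a = word (a % n)

  G-cong : ∀ {a b} → a ≋ b → G a ≡ G b
  G-cong = cong word ∘ %≡

  base : ℕ → ℕ → ℕ
  base x y = 3 * (n * x + y)

  weight : (V → ℕ) → ℕ → ℕ → ℕ
  weight h x y = h (G (x + m * y))

  -- The base layer carries 3(nx + y) on the diagonal z = x + y; the letter G (x − y) of the word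
  -- carries the weights h₁, h₂, h₃ on the diagonals shifted by 1, −1 and 2.
  cell : ℕ → ℕ → ℕ → ℕ
  cell x y z = layer 0 base x y z
             + (layer 1 (weight h₁) x y z + layer m (weight h₂) x y z + layer 2 (weight h₃) x y z)

  cube : Cube n
  cube i j k = cell (toℕ i) (toℕ j) (toℕ k)

  ∑-layers : (ℓ : ℕ → (ℕ → ℕ → ℕ) → Fin n → ℕ) →
             ∑ (λ t → ℓ 0 base t + (ℓ 1 (weight h₁) t + ℓ m (weight h₂) t + ℓ 2 (weight h₃) t))
             ≡ ∑ (ℓ 0 base) + (∑ (ℓ 1 (weight h₁)) + ∑ (ℓ m (weight h₂)) + ∑ (ℓ 2 (weight h₃)))
  ∑-layers ℓ = ∑-distrib-+₄ (ℓ 0 base) (ℓ 1 (weight h₁)) (ℓ m (weight h₂)) (ℓ 2 (weight h₃))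

  excessₖ excessⱼ excessᵢ : ℕ → ℕ
  excessₖ e = h₁ (G e) + h₂ (G e) + h₃ (G e)
  excessⱼ e = h₁ (G (e + 1)) + h₂ (G (e + m)) + h₃ (G (e + 2))
  excessᵢ e = h₁ (G (e + m)) + h₂ (G (e + 1)) + h₃ (G (e + m * 2))

  module _ (x y : ℕ) where

    ε : ℕ
    ε = x + m * y

    diagonalⱼ : ∀ c {z} → z ≋ x + y → x + m * (z ⊖ (c + x)) ≋ ε + c
    diagonalⱼ c {z} z≋x+y = begin
      x + m * (z ⊖ (c + x))                       ≈⟨ ≋-+ ≋-refl (≋-*ˡ m (%-≋ (z + m * (c + x)))) ⟩
      x + m * (z + m * (c + x))                   ≈⟨ ≋-+ ≋-refl (≋-*ˡ m (≋-+ z≋x+y ≋-refl)) ⟩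
      x + m * (x + y + m * (c + x))               ≈⟨ ≋-by c (m * x + m * c) (identity m c x y) ⟩
      x + m * y + c                               ∎
      where
      open ≈-Reasoning ≋-setoid
      identity : ∀ m c x y → x + m * (x + y + m * (c + x)) + c * suc m ≡ x + m * y + c + (m * x + m * c) * suc m
      identity = solve-∀

    diagonalᵢ : ∀ c d {z} → z ≋ x + y → c + d ≋ 0 → (z ⊖ (c + y)) + m * y ≋ ε + d
    diagonalᵢ c d {z} z≋x+y c+d≋0 = begin
      (z ⊖ (c + y)) + m * y                       ≈⟨ ≋-+ (%-≋ (z + m * (c + y))) ≋-refl ⟩
      z + m * (c + y) + m * y                     ≈⟨ ≋-+ (≋-+ z≋x+y ≋-refl) ≋-refl ⟩
      x + y + m * (c + y) + m * y                 ≡⟨ +-identityʳ _ ⟨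
      x + y + m * (c + y) + m * y + 0             ≈⟨ ≋-+ ≋-refl c+d≋0 ⟨
      x + y + m * (c + y) + m * y + (c + d)       ≈⟨ ≋-by 0 (c + y) (identity m c d x y) ⟩
      x + m * y + d                               ∎
      where
      open ≈-Reasoning ≋-setoid
      identity : ∀ m c d x y → x + y + m * (c + y) + m * y + (c + d) + 0 * suc m ≡ x + m * y + d + (c + y) * suc m
      identity = solve-∀

    ∑ₖ-cell : ∑ {n} (λ k → cell x y (toℕ k)) ≡ base x y + excessₖ ε
    ∑ₖ-cell = trans (∑-layers ℓ)
      (cong₂ _+_ (∑ₖ-layer 0 base x y)
        (cong₂ _+_ (cong₂ _+_ (∑ₖ-layer 1 (weight h₁) x y) (∑ₖ-layer m (weight h₂) x y))
                   (∑ₖ-layer 2 (weight h₃) x y)))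
      where
      ℓ : ℕ → (ℕ → ℕ → ℕ) → Fin n → ℕ
      ℓ c f k = layer c f x y (toℕ k)

    ∑ⱼ-cell : ∀ {z} → y < n → z < n → z ≋ x + y →
              ∑ {n} (λ j → cell x (toℕ j) z) ≡ base x y + excessⱼ ε
    ∑ⱼ-cell {z} y<n z<n z≋x+y = trans (∑-layers ℓ)
      (cong₂ _+_ (trans (∑ⱼ-layer 0 base x z<n) (cong (base x) (sym (⊖-unique x z y<n (≋-sym z≋x+y)))))
        (cong₂ _+_ (cong₂ _+_ (shifted 1 h₁) (shifted m h₂)) (shifted 2 h₃)))
      where
      ℓ : ℕ → (ℕ → ℕ → ℕ) → Fin n → ℕ
      ℓ c f j = layer c f x (toℕ j) z
      shifted : ∀ c h → ∑ (ℓ c (weight h)) ≡ h (G (ε + c))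
      shifted c h = trans (∑ⱼ-layer c (weight h) x z<n) (cong h (G-cong (diagonalⱼ c z≋x+y)))

    ∑ᵢ-cell : ∀ {z} → x < n → z < n → z ≋ x + y →
              ∑ {n} (λ i → cell (toℕ i) y z) ≡ base x y + excessᵢ ε
    ∑ᵢ-cell {z} x<n z<n z≋x+y = trans (∑-layers ℓ)
      (cong₂ _+_ (trans (∑ᵢ-layer 0 base y z<n) (cong (λ t → base t y) (sym (⊖-unique y z x<n y+x≋z))))
        (cong₂ _+_ (cong₂ _+_ (shifted 1 m n≋0 h₁) (shifted m 1 m+1≋0 h₂)) (shifted 2 (m * 2) 2+2m≋0 h₃)))
      where
      ℓ : ℕ → (ℕ → ℕ → ℕ) → Fin n → ℕ
      ℓ c f i = layer c f (toℕ i) y z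
      shifted : ∀ c d → c + d ≋ 0 → ∀ h → ∑ (ℓ c (weight h)) ≡ h (G (ε + d))
      shifted c d c+d≋0 h = trans (∑ᵢ-layer c (weight h) y z<n) (cong h (G-cong (diagonalᵢ c d z≋x+y c+d≋0)))
      y+x≋z : y + x ≋ z
      y+x≋z = ≋-sym (≋-trans z≋x+y (≋-reflexive (+-comm x y)))
      n≋0 : n ≋ 0
      n≋0 = mod≡ (n%n≡0 n)
      m+1≋0 : m + 1 ≋ 0
      m+1≋0 = ≋-trans (≋-reflexive (+-comm m 1)) n≋0
      2+2m≋0 : 2 + m * 2 ≋ 0
      2+2m≋0 = ≋-by 0 2 (identity m)
        where
        identity : ∀ m → 2 + m * 2 + 0 * suc m ≡ 0 + 2 * suc m
        identity = solve-∀

  module _ (balanced : ∀ s → Balanced (window G s)) where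

    -- ε + 2m ≡ ε − 2, so the window starting there is centred at ε
    covers-at : ∀ ε → Covers (excessₖ ε) (excessⱼ ε) (excessᵢ ε)
    covers-at ε = subst Balanced recentre (balanced (ε + m * 2))
      where
      recentre : window G (ε + m * 2) ≡ (G (ε + m * 2) , G (ε + m) , G ε , G (ε + 1) , G (ε + 2))
      recentre = cong₂ _,_ (cong G (+-identityʳ (ε + m * 2)))
                  (cong₂ _,_ (G-cong (≋-by 0 1 (identity₁ m ε)))
                  (cong₂ _,_ (G-cong (≋-by 0 2 (identity₂ m ε)))
                  (cong₂ _,_ (G-cong (≋-by 0 2 (identity₃ m ε))) (G-cong (≋-by 0 2 (identity₄ m ε))))))
        where
        identity₁ : ∀ m e → e + m * 2 + 1 + 0 * suc m ≡ e + m + 1 * suc m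
        identity₁ = solve-∀
        identity₂ : ∀ m e → e + m * 2 + 2 + 0 * suc m ≡ e + 2 * suc m
        identity₂ = solve-∀
        identity₃ : ∀ m e → e + m * 2 + 3 + 0 * suc m ≡ e + 1 + 2 * suc m
        identity₃ = solve-∀
        identity₄ : ∀ m e → e + m * 2 + 4 + 0 * suc m ≡ e + 2 + 2 * suc m
        identity₄ = solve-∀

    isSBC : IsSBC n cube
    isSBC = isSBC-if-all-occur cube occurs
      where
      line-value : ∀ i j (r : Fin 3) → base (toℕ i) (toℕ j) + toℕ r ∈ lineSums cube
      line-value i j r = on-some-line (All.lookup (covers-at (ε x y)) (∈-upTo⁺ (toℕ<n r)))
        where
        x y : ℕ
        x = toℕ i
        y = toℕ j
        k : Fin n
        k = (x + y) mod n
        k≋x+y : toℕ k ≋ x + y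
        k≋x+y = ≋-trans (≋-reflexive (toℕ-fromℕ< (m%n<n (x + y) n))) (%-≋ (x + y))
        on-line : ∀ {e l} → l ∈ lineSums cube → l ≡ base x y + e → toℕ r ≡ e → base x y + toℕ r ∈ lineSums cube
        on-line l∈ l≡ r≡e = subst (_∈ lineSums cube) (trans l≡ (cong (base x y +_) (sym r≡e))) l∈
        on-some-line : toℕ r ∈ excessₖ (ε x y) ∷ excessⱼ (ε x y) ∷ excessᵢ (ε x y) ∷ [] →
                       base x y + toℕ r ∈ lineSums cube
        on-some-line (here r≡K) =
          on-line (∑ₖ∈lineSums cube i j) (∑ₖ-cell x y) r≡K
        on-some-line (there (here r≡J)) =
          on-line (∑ⱼ∈lineSums cube i k) (∑ⱼ-cell x y (toℕ<n j) (toℕ<n k) k≋x+y) r≡J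
        on-some-line (there (there (here r≡I))) =
          on-line (∑ᵢ∈lineSums cube j k) (∑ᵢ-cell x y (toℕ<n i) (toℕ<n k) k≋x+y) r≡I
      occurs : ∀ v → v < 3 * (n * n) → v ∈ lineSums cube
      occurs v v<3n² with digits n v v<3n²
      ... | i , j , r , refl = line-value i j r

-- Words of every length

covers? : ∀ a b c → Dec (Covers a b c)
covers? a b c = all? (_∈? a ∷ b ∷ c ∷ []) (upTo 3)

balanced? : ∀ w → Dec (Balanced w)
balanced? ((_ , _ , c₀) , (a₁ , b₁ , _) , (a₂ , b₂ , c₂) , (a₃ , b₃ , _) , (_ , _ , c₄)) =
  covers? (a₂ + b₂ + c₂) (a₃ + b₁ + c₄) (a₁ + b₃ + c₀)

isSBC-by-evaluation : ∀ {n} (C : Cube n) → {True (all? (_∈? lineSums C) (upTo (3 * (n * n))))} → IsSBC n C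
isSBC-by-evaluation C {t} = isSBC-if-all-occur C (λ v v< → All.lookup (toWitness t) (∈-upTo⁺ v<))

blank : V
blank = 0 , 0 , 0

blockA : State V
blockA = (0 , 0 , 0) , (0 , 1 , 1) , (0 , 1 , 1) , (0 , 0 , 0)

blocks-balanced : All Balanced (windowsFrom blockA (toList₄ blockA))
blocks-balanced = toWitness {a? = all? balanced? (windowsFrom blockA (toList₄ blockA))} _

record Tail (r : ℕ) : Set where
  field
    head        : State V
    body        : List V
    length-body : length body ≡ r
    alone       : All Balanced (windowsFrom head (body ++ toList₄ head))
    into-blocks : All Balanced (windowsFrom head (toList₄ blockA))
    from-blocks : All Balanced (windowsFrom blockA (body ++ toList₄ head))

tail-by-evaluation : ∀ head body →
  {True (all? balanced? (windowsFrom head (body ++ toList₄ head)))} →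
  {True (all? balanced? (windowsFrom head (toList₄ blockA)))} →
  {True (all? balanced? (windowsFrom blockA (body ++ toList₄ head)))} →
  Tail (length body)
tail-by-evaluation head body {alone} {into} {from} = record
  { head = head ; body = body ; length-body = refl
  ; alone = toWitness alone ; into-blocks = toWitness into ; from-blocks = toWitness from }

tail : ∀ r → r < 4 → Tail r
tail 0 _ = tail-by-evaluation blockA []
tail 1 _ = tail-by-evaluation ((0 , 1 , 1) , (0 , 0 , 1) , (1 , 0 , 1) , (0 , 0 , 0)) ((0 , 0 , 0) ∷ [])
tail 2 _ = tail-by-evaluation ((0 , 0 , 2) , (0 , 0 , 2) , (0 , 0 , 1) , (0 , 0 , 0)) ((0 , 0 , 0) ∷ (0 , 0 , 1) ∷ [])
tail 3 _ = tail-by-evaluation blockA ((0 , 1 , 0) ∷ (0 , 1 , 0) ∷ (1 , 0 , 0) ∷ [])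
tail (suc (suc (suc (suc _)))) (s≤s (s≤s (s≤s (s≤s ()))))

SBC : ℕ → Set
SBC n = Σ (Cube n) (IsSBC n)

sbc-from-tail : ∀ {r} k → Tail r → SBC (4 + (k * 4 + r))
sbc-from-tail {r} k T = subst SBC (cong (4 +_) |u|≡) (cube , isSBC balanced)
  where
  open Tail T
  u : List V
  u = blocks k blockA ++ body
  open Construction (3 + length u) (at blank (toList₄ head ++ u))
  balanced : ∀ s → Balanced (window G s)
  balanced = windows-of-cycle blank head u (All-windowsFrom-cyclic alone into-blocks blocks-balanced from-blocks k)
  |u|≡ : length u ≡ k * 4 + r
  |u|≡ = trans (length-++ (blocks k blockA)) (cong₂ _+_ (length-blocks k blockA) length-body)

sbc≥4 : ∀ q → SBC (4 + q)
sbc≥4 q = subst (λ t → SBC (4 + t)) q≡ (sbc-from-tail (q / 4) (tail (q % 4) (m%n<n q 4)))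
  where
  q≡ : q / 4 * 4 + q % 4 ≡ q
  q≡ = trans (+-comm (q / 4 * 4) (q % 4)) (sym (m≡m%n+[m/n]*n q 4))

C₂ : Cube 2
C₂ zero       zero       zero       = 0
C₂ zero       zero       (suc zero) = 0
C₂ zero       (suc zero) zero       = 1
C₂ zero       (suc zero) (suc zero) = 2
C₂ (suc zero) zero       zero       = 4
C₂ (suc zero) zero       (suc zero) = 6
C₂ (suc zero) (suc zero) zero       = 4
C₂ (suc zero) (suc zero) (suc zero) = 5

theorem1 : (n : ℕ) → 2 ≤ n → Σ (Cube n) (λ C → IsSBC n C)
theorem1 2 _ = C₂ , isSBC-by-evaluation C₂
theorem1 3 _ = cube₃ , isSBC-by-evaluation cube₃
  where
  open Construction 2 (at blank ((0 , 0 , 0) ∷ (0 , 0 , 1) ∷ (0 , 0 , 2) ∷ [])) renaming (cube to cube₃)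
theorem1 (suc (suc (suc (suc q)))) _ = sbc≥4 q
theorem1 1 (s≤s ())
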